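{- For all integers $n\ge 3$ and $m\ge 1$, $Z(C_n\boxtimes P_m)\le n+2m-2$ and $Z_c(C_n\boxtimes P_m)\le n+2m-2$.
   Context: All graphs are finite and simple. Color-change rule: if a black vertex $u$ has exactly one white neighbor $v$, then $v$ becomes black. A zero forcing set of $G$ is a set $Z\subseteq V(G)$ such that, starting with exactly $Z$ black, repeated application of the rule makes all vertices black; $Z(G)$ is the minimum size of a zero forcing set. A connected zero forcing set is a zero forcing set $S$ such that for every connected component $C$ of $G$, $S\cap V(C)$ induces a connected subgraph; $Z_c(G)$ is the minimum size of one. $C_n$ is the cycle and $P_m$ the path on the indicated number of vertices. The strong product $G\boxtimes H$ has vertex set $V(G)\times V(H)$, with $(u,v)$ adjacent to $(u',v')$ iff ($u=u'$ and $vv'\in E(H)$) or ($v=v'$ and $uu'\in E(G)$) or ($uu'\in E(G)$ and $vv'\in E(H)$). -}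

module Defs where

open import Data.Nat using (ℕ; zero; suc; _≤_)
open import Data.Fin using (Fin; toℕ)
open import Data.Product using (_×_; _,_; proj₁; proj₂; ∃-syntax; Σ-syntax)
open import Data.Sum using (_⊎_)
open import Data.List using (List; length)
open import Data.List.Membership.Propositional using (_∈_)
open import Data.List.Relation.Unary.Unique.Propositional using (Unique)
open import Relation.Binary.PropositionalEquality using (_≡_; _≢_)
open import Level using (0ℓ)

record Graph : Set₁ where
  field
    Vertex : Set
    Adj    : Vertex → Vertex → Set
open Graph public

Cycle : ℕ → Graph
Cycle n = record
  { Vertex = Fin n
  ; Adj = λ i j → (suc (toℕ i) ≡ toℕ j) ⊎ (suc (toℕ j) ≡ toℕ i)
                ⊎ ((toℕ i ≡ 0) × (suc (toℕ j) ≡ n))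
                ⊎ ((toℕ j ≡ 0) × (suc (toℕ i) ≡ n))
  }

PathG : ℕ → Graph
PathG m = record
  { Vertex = Fin m
  ; Adj = λ i j → (suc (toℕ i) ≡ toℕ j) ⊎ (suc (toℕ j) ≡ toℕ i)
  }

_⊠_ : Graph → Graph → Graph
G ⊠ H = record
  { Vertex = Vertex G × Vertex H
  ; Adj = λ p q →
      ((proj₁ p ≡ proj₁ q) × Adj H (proj₂ p) (proj₂ q))
      ⊎ ((proj₂ p ≡ proj₂ q) × Adj G (proj₁ p) (proj₁ q))
      ⊎ (Adj G (proj₁ p) (proj₁ q) × Adj H (proj₂ p) (proj₂ q))
  }

-- Vertices that end up black when starting from exactly the set Z black and
-- applying the color-change rule repeatedly (the final coloring is the least
-- set containing Z and closed under the rule: if u is black, v is a neighbour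
-- of u, and every neighbour w ≠ v of u is black, then v becomes black).
data Black (G : Graph) (Z : List (Vertex G)) : Vertex G → Set where
  initial : ∀ {v} → v ∈ Z → Black G Z v
  force   : ∀ {u v} → Black G Z u → Adj G u v
          → (∀ w → Adj G u w → w ≢ v → Black G Z w)
          → Black G Z v

IsZeroForcingSet : (G : Graph) → List (Vertex G) → Set
IsZeroForcingSet G Z = ∀ v → Black G Z v

data WalkIn (G : Graph) (P : Vertex G → Set) : Vertex G → Vertex G → Set where
  here : ∀ {u} → P u → WalkIn G P u u
  step : ∀ {u v w} → P u → Adj G u v → WalkIn G P v w → WalkIn G P u w

SameComponent : (G : Graph) → Vertex G → Vertex G → Set
SameComponent G u v = WalkIn G (λ _ → Data.Unit.⊤) u v
  where import Data.Unit

-- Connected zero forcing set: zero forcing, and for every component C,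
-- S ∩ V(C) induces a connected subgraph (any two vertices of S in the same
-- component are joined by a walk using only vertices of S).
IsConnectedZeroForcingSet : (G : Graph) → List (Vertex G) → Set
IsConnectedZeroForcingSet G S =
  IsZeroForcingSet G S ×
  (∀ u v → u ∈ S → v ∈ S → SameComponent G u v → WalkIn G (λ w → w ∈ S) u v)

ZeroForcingNumber≤ : Graph → ℕ → Set
ZeroForcingNumber≤ G k = ∃[ S ] (Unique S × IsZeroForcingSet G S × length S ≤ k)

ConnectedZeroForcingNumber≤ : Graph → ℕ → Set
ConnectedZeroForcingNumber≤ G k =
  ∃[ S ] (Unique S × IsConnectedZeroForcingSet G S × length S ≤ k)

module Submission where

-- Picture C_n ⊠ P_m as a grid with columns 0..n-1 (the cycle) and rows
-- 0..m-1 (the path).  The set Z consists of the whole bottom row together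
-- with the rest of columns 0 and 1; it has n + 2(m-1) vertices.
--
-- We fill the grid in row-major order: a vertex (a , b) with
-- a ≥ 2 and b ≥ 1 is forced by its lower-left diagonal neighbour
-- (a-1 , b-1).  Since 1 ≤ a-1 ≤ n-2, that vertex does not use the wrap-around
-- edge of the cycle, so all its neighbours lie in columns ≤ a and rows ≤ b;
-- apart from (a , b) itself they all precede (a , b) in row-major order.
--
-- Every vertex of Z is joined to the corner (0 , 0) by a walk
-- inside Z (along the bottom row, up column 0, plus one step to column 1);
-- as adjacency is symmetric, any two vertices of Z are then joined via (0 , 0).

open import Defs
open import Level using (0ℓ)
open import Data.Nat using (ℕ; zero; suc; _≤_; _+_; _*_; _∸_; s≤s; z≤n)
open import Data.Nat.Properties
  using (≤-reflexive; n≤1+n; m≤n⇒m≤1+n; <⇒≤; ≤∧≢⇒<; m≤n⇒m<n∨m≡n; m+n∸n≡m)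
open import Data.Nat.Solver using (module +-*-Solver)
open import Data.Fin using (Fin; zero; suc; toℕ; inject₁; _<_)
open import Data.Fin.Properties using (toℕ-inject₁; toℕ-injective)
open import Data.Fin.Induction
  using (<-weakInduction) renaming (<-wellFounded to Fin-<-wellFounded)
open import Data.Product using (_×_; _,_; ∃-syntax; swap)
open import Data.Product.Relation.Binary.Lex.Strict using (×-Lex; ×-wellFounded)
open import Data.Sum using (_⊎_; inj₁; inj₂)
open import Data.List using (List; length; map; _++_; allFin)
open import Data.List.Properties using (length-++; length-map; length-tabulate)
open import Data.List.Membership.Propositional using (_∈_)
open import Data.List.Membership.Propositional.Properties
  using (∈-map⁺; ∈-map⁻; ∈-++⁺ˡ; ∈-++⁺ʳ; ∈-++⁻; ∈-allFin)
open import Data.List.Relation.Unary.Unique.Propositional using (Unique)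
open import Data.List.Relation.Unary.Unique.Propositional.Properties
  using (map⁺; ++⁺; allFin⁺)
open import Data.List.Relation.Binary.Disjoint.Propositional using (Disjoint)
open import Relation.Binary.Core using (Rel)
open import Relation.Binary.Definitions using (Symmetric)
open import Relation.Binary.Construct.On as On using ()
open import Function.Base using (_on_)
open import Induction.WellFounded using (WellFounded; Acc; acc)
open import Relation.Nullary using (contradiction)
open import Relation.Binary.PropositionalEquality

module _ {G : Graph} {P : Vertex G → Set} where

  walk-++ : ∀ {u v w} → WalkIn G P u v → WalkIn G P v w → WalkIn G P u w
  walk-++ (here _)        q = q
  walk-++ (step pu uv p) q = step pu uv (walk-++ p q)

  walk-snoc : ∀ {u v w} → WalkIn G P u v → Adj G v w → P w → WalkIn G P u w
  walk-snoc (here pu)       vw pw = step pu vw (here pw)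
  walk-snoc (step pu uv p) vw pw = step pu uv (walk-snoc p vw pw)

  walk-reverse : Symmetric (Adj G) → ∀ {u v} → WalkIn G P u v → WalkIn G P v u
  walk-reverse sym (here pu)       = here pu
  walk-reverse sym (step pu uv p) = walk-snoc (walk-reverse sym p) (sym uv) pu

  ladder : ∀ {k} (f : Fin (suc k) → Vertex G) → (∀ i → P (f i)) →
           (∀ i → Adj G (f (inject₁ i)) (f (suc i))) →
           ∀ i → WalkIn G P (f zero) (f i)
  ladder f inP rung =
    <-weakInduction (λ i → WalkIn G P (f zero) (f i))
      (here (inP zero))
      (λ i p → walk-snoc p (rung i) (inP (suc i)))

hub-connected : ∀ {G} (S : List (Vertex G)) (h : Vertex G) →
  Symmetric (Adj G) → (∀ s → s ∈ S → WalkIn G (_∈ S) h s) →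
  ∀ u v → u ∈ S → v ∈ S → SameComponent G u v → WalkIn G (_∈ S) u v
hub-connected S h sym fromHub u v u∈S v∈S _ =
  walk-++ (walk-reverse sym (fromHub u u∈S)) (fromHub v v∈S)

ForcingSchedule : (G : Graph) → List (Vertex G) → Rel (Vertex G) 0ℓ → Set
ForcingSchedule G Z _≺_ =
  ∀ v → v ∈ Z ⊎ ∃[ u ] (u ≺ v × Adj G u v × (∀ w → Adj G u w → w ≢ v → w ≺ v))

schedule⇒zeroForcing : ∀ {G Z _≺_} → WellFounded _≺_ →
  ForcingSchedule G Z _≺_ → IsZeroForcingSet G Z
schedule⇒zeroForcing {G} {Z} {_≺_} wf schedule v = black v (wf v)
  where
  black : ∀ v → Acc _≺_ v → Black G Z v
  black v (acc smaller) with schedule v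
  ... | inj₁ v∈Z = initial v∈Z
  ... | inj₂ (u , u≺v , uv , others) =
    force (black u (smaller u≺v)) uv (λ w uw w≢v → black w (smaller (others w uw w≢v)))

cycle-symmetric : ∀ n → Symmetric (Adj (Cycle n))
cycle-symmetric n (inj₁ e)               = inj₂ (inj₁ e)
cycle-symmetric n (inj₂ (inj₁ e))        = inj₁ e
cycle-symmetric n (inj₂ (inj₂ (inj₁ p))) = inj₂ (inj₂ (inj₂ p))
cycle-symmetric n (inj₂ (inj₂ (inj₂ p))) = inj₂ (inj₂ (inj₁ p))

path-symmetric : ∀ m → Symmetric (Adj (PathG m))
path-symmetric m (inj₁ e) = inj₂ e
path-symmetric m (inj₂ e) = inj₁ e

⊠-symmetric : ∀ {G H} → Symmetric (Adj G) → Symmetric (Adj H) → Symmetric (Adj (G ⊠ H))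
⊠-symmetric symG symH (inj₁ (e , q))        = inj₁ (sym e , symH q)
⊠-symmetric symG symH (inj₂ (inj₁ (e , p))) = inj₂ (inj₁ (sym e , symG p))
⊠-symmetric symG symH (inj₂ (inj₂ (p , q))) = inj₂ (inj₂ (symG p , symH q))

cycle-succ : ∀ {n} (i : Fin n) → Adj (Cycle (suc n)) (inject₁ i) (suc i)
cycle-succ i = inj₁ (cong suc (toℕ-inject₁ i))

path-succ : ∀ {m} (i : Fin m) → Adj (PathG (suc m)) (inject₁ i) (suc i)
path-succ i = inj₁ (cong suc (toℕ-inject₁ i))

module ⊠-Edges (G H : Graph) where

  ⊠-horizontal : ∀ {a a′ b} → Adj G a a′ → Adj (G ⊠ H) (a , b) (a′ , b)
  ⊠-horizontal p = inj₂ (inj₁ (refl , p))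

  ⊠-vertical : ∀ {a b b′} → Adj H b b′ → Adj (G ⊠ H) (a , b) (a , b′)
  ⊠-vertical q = inj₁ (refl , q)

  ⊠-diagonal : ∀ {a a′ b b′} → Adj G a a′ → Adj H b b′ → Adj (G ⊠ H) (a , b) (a′ , b′)
  ⊠-diagonal p q = inj₂ (inj₂ (p , q))

  ⊠-neighbour : ∀ {a a′ b b′} → Adj (G ⊠ H) (a , b) (a′ , b′) →
    (a′ ≡ a ⊎ Adj G a a′) × (b′ ≡ b ⊎ Adj H b b′)
  ⊠-neighbour (inj₁ (e , q))        = inj₁ (sym e) , inj₂ q
  ⊠-neighbour (inj₂ (inj₁ (e , p))) = inj₂ p , inj₁ (sym e)
  ⊠-neighbour (inj₂ (inj₂ (p , q))) = inj₂ p , inj₂ q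

-- Away from vertex 0 (where the wrap-around edge sits) a cycle vertex c has
-- no closed neighbour beyond c + 1.
cycle-neighbour-bound : ∀ {n} {c x : Fin n} → toℕ c ≢ 0 →
  x ≡ c ⊎ Adj (Cycle n) c x → toℕ x ≤ suc (toℕ c)
cycle-neighbour-bound c≢0 (inj₁ refl)                   = n≤1+n _
cycle-neighbour-bound c≢0 (inj₂ (inj₁ e))               = ≤-reflexive (sym e)
cycle-neighbour-bound c≢0 (inj₂ (inj₂ (inj₁ e)))        = m≤n⇒m≤1+n (<⇒≤ (≤-reflexive e))
cycle-neighbour-bound c≢0 (inj₂ (inj₂ (inj₂ (inj₁ (c≡0 , _))))) = contradiction c≡0 c≢0
cycle-neighbour-bound c≢0 (inj₂ (inj₂ (inj₂ (inj₂ (x≡0 , _))))) = subst (_≤ _) (sym x≡0) z≤n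

path-neighbour-bound : ∀ {m} {d y : Fin m} → y ≡ d ⊎ Adj (PathG m) d y → toℕ y ≤ suc (toℕ d)
path-neighbour-bound (inj₁ refl)     = n≤1+n _
path-neighbour-bound (inj₂ (inj₁ e)) = ≤-reflexive (sym e)
path-neighbour-bound (inj₂ (inj₂ e)) = m≤n⇒m≤1+n (<⇒≤ (≤-reflexive e))

_≺_ : ∀ {n m} → Rel (Fin n × Fin m) 0ℓ
_≺_ = ×-Lex _≡_ _<_ _<_ on swap

≺-wellFounded : ∀ {n m} → WellFounded (_≺_ {n} {m})
≺-wellFounded = On.wellFounded swap (×-wellFounded Fin-<-wellFounded Fin-<-wellFounded)

below-corner : ∀ {n m} {x a : Fin n} {y b : Fin m} →
  toℕ x ≤ toℕ a → toℕ y ≤ toℕ b → (x , y) ≢ (a , b) → (x , y) ≺ (a , b)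
below-corner x≤a y≤b xy≢ab with m≤n⇒m<n∨m≡n y≤b
... | inj₁ y<b = inj₁ y<b
... | inj₂ y≡b = inj₂ (y=b , ≤∧≢⇒< x≤a (λ x≡a → xy≢ab (cong₂ _,_ (toℕ-injective x≡a) y=b)))
  where y=b = toℕ-injective y≡b

module _ {A : Set} where

  map-disjoint : ∀ {B C : Set} {f : B → A} {g : C → A} {xs ys} →
    (∀ x y → f x ≢ g y) → Disjoint (map f xs) (map g ys)
  map-disjoint {f = f} {g} f≢g (p , q) with ∈-map⁻ f p | ∈-map⁻ g q
  ... | x , _ , refl | y , _ , fx≡gy = f≢g x y fx≡gy

  disjoint-++ʳ : ∀ {xs ys zs : List A} → Disjoint xs ys → Disjoint xs zs →
    Disjoint xs (ys ++ zs)
  disjoint-++ʳ {ys = ys} xs#ys xs#zs (p , q) with ∈-++⁻ ys q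
  ... | inj₁ q∈ys = xs#ys (p , q∈ys)
  ... | inj₂ q∈zs = xs#zs (p , q∈zs)

  length-map-allFin : ∀ {k} (f : Fin k → A) → length (map f (allFin k)) ≡ k
  length-map-allFin {k} f = trans (length-map f (allFin k)) (length-tabulate {n = k} (λ i → i))

succ-inject₁-bound : ∀ {k t} (i : Fin k) → t ≤ suc (toℕ (inject₁ i)) → t ≤ toℕ (suc i)
succ-inject₁-bound {t = t} i = subst (λ s → t ≤ suc s) (toℕ-inject₁ i)

module Grid (n' m' : ℕ) where

  N M : ℕ
  N = suc (suc (suc n'))
  M = suc m'

  G : Graph
  G = Cycle N ⊠ PathG M

  V : Set
  V = Fin N × Fin M

  open ⊠-Edges (Cycle N) (PathG M)

  step-right : ∀ (i : Fin (suc (suc n'))) b → Adj G (inject₁ i , b) (suc i , b)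
  step-right i b = ⊠-horizontal {a = inject₁ i} {a′ = suc i} {b = b} (cycle-succ i)

  step-up : ∀ a (j : Fin m') → Adj G (a , inject₁ j) (a , suc j)
  step-up a j = ⊠-vertical {a = a} {b = inject₁ j} {b′ = suc j} (path-succ j)

  step-diagonal : ∀ (i : Fin (suc (suc n'))) (j : Fin m') →
    Adj G (inject₁ i , inject₁ j) (suc i , suc j)
  step-diagonal i j =
    ⊠-diagonal {a = inject₁ i} {suc i} {inject₁ j} {suc j} (cycle-succ i) (path-succ j)

  row₀ : Fin N → V
  row₀ a = (a , zero)

  upper : Fin N → Fin m' → V
  upper c b = (c , suc b)

  bottomRow : List V
  bottomRow = map row₀ (allFin N)

  column : Fin N → List V
  column c = map (upper c) (allFin m')

  Z : List V
  Z = bottomRow ++ (column zero ++ column (suc zero))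

  ∈Z-row : ∀ a → (a , zero) ∈ Z
  ∈Z-row a = ∈-++⁺ˡ (∈-map⁺ row₀ (∈-allFin a))

  ∈Z-col₀ : ∀ b → (zero , b) ∈ Z
  ∈Z-col₀ zero    = ∈Z-row zero
  ∈Z-col₀ (suc b) = ∈-++⁺ʳ bottomRow (∈-++⁺ˡ (∈-map⁺ (upper zero) (∈-allFin b)))

  ∈Z-col₁ : ∀ b → (suc zero , b) ∈ Z
  ∈Z-col₁ zero    = ∈Z-row (suc zero)
  ∈Z-col₁ (suc b) = ∈-++⁺ʳ bottomRow
    (∈-++⁺ʳ (column zero) (∈-map⁺ (upper (suc zero)) (∈-allFin b)))

  bottomRow-unique : Unique bottomRow
  bottomRow-unique = map⁺ (λ { refl → refl }) (allFin⁺ N)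

  column-unique : ∀ c → Unique (column c)
  column-unique c = map⁺ (λ { refl → refl }) (allFin⁺ m')

  bottomRow#column : ∀ c → Disjoint bottomRow (column c)
  bottomRow#column c = map-disjoint {f = row₀} {g = upper c} (λ _ _ ())

  column₀#column₁ : Disjoint (column zero) (column (suc zero))
  column₀#column₁ = map-disjoint {f = upper zero} {g = upper (suc zero)} (λ _ _ ())

  Z-unique : Unique Z
  Z-unique =
    ++⁺ bottomRow-unique
        (++⁺ (column-unique zero) (column-unique (suc zero)) column₀#column₁)
        (disjoint-++ʳ (bottomRow#column zero) (bottomRow#column (suc zero)))

  Z-size : length Z ≡ N + 2 * M ∸ 2
  Z-size = begin
    length Z                   ≡⟨ length-++ bottomRow ⟩
    _                          ≡⟨ cong₂ _+_ (length-map-allFin row₀) columns ⟩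
    N + (m' + m')              ≡⟨ sym (m+n∸n≡m (N + (m' + m')) 2) ⟩
    N + (m' + m') + 2 ∸ 2      ≡⟨ cong (_∸ 2) (count n' m') ⟩
    N + 2 * M ∸ 2              ∎
    where
    open ≡-Reasoning
    open +-*-Solver
    columns : length (column zero ++ column (suc zero)) ≡ m' + m'
    columns = trans (length-++ (column zero))
                    (cong₂ _+_ (length-map-allFin (upper zero)) (length-map-allFin (upper (suc zero))))
    count : ∀ n m → 3 + n + (m + m) + 2 ≡ 3 + n + 2 * (1 + m)
    count = solve 2 (λ n m → con 3 :+ n :+ (m :+ m) :+ con 2 := con 3 :+ n :+ con 2 :* (con 1 :+ m)) refl

  -- (a + 2 , b + 1) is forced by (a + 1 , b); all other neighbours of the
  -- forcer lie weakly below and left of (a + 2 , b + 1).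
  schedule : ForcingSchedule G Z _≺_
  schedule (zero , b)               = inj₁ (∈Z-col₀ b)
  schedule (suc zero , b)           = inj₁ (∈Z-col₁ b)
  schedule (suc (suc a) , zero)     = inj₁ (∈Z-row (suc (suc a)))
  schedule (suc (suc a) , suc b)    =
    inj₂ (forcer , inj₁ (s≤s (≤-reflexive (toℕ-inject₁ b)))
         , step-diagonal (suc a) b , others)
    where
    forcer : V
    forcer = (inject₁ (suc a) , inject₁ b)
    others : ∀ w → Adj G forcer w → w ≢ (suc (suc a) , suc b) → w ≺ (suc (suc a) , suc b)
    others (x , y) adj w≢v with ⊠-neighbour adj
    ... | x-near , y-near =
      below-corner (succ-inject₁-bound (suc a) (cycle-neighbour-bound (λ ()) x-near))
                   (succ-inject₁-bound b (path-neighbour-bound y-near)) w≢v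

  Z-zeroForcing : IsZeroForcingSet G Z
  Z-zeroForcing = schedule⇒zeroForcing {G} ≺-wellFounded schedule

  hub : V
  hub = (zero , zero)

  hub→row : ∀ a → WalkIn G (_∈ Z) hub (a , zero)
  hub→row = ladder row₀ ∈Z-row (λ i → step-right i zero)

  hub→col₀ : ∀ b → WalkIn G (_∈ Z) hub (zero , b)
  hub→col₀ = ladder (λ b → (zero , b)) ∈Z-col₀ (step-up zero)

  hub→col₁ : ∀ b → WalkIn G (_∈ Z) hub (suc zero , b)
  hub→col₁ b = walk-snoc (hub→col₀ b) (step-right zero b) (∈Z-col₁ b)

  hub→Z : ∀ s → s ∈ Z → WalkIn G (_∈ Z) hub s
  hub→Z s s∈Z with ∈-++⁻ bottomRow s∈Z
  ... | inj₁ s∈row with ∈-map⁻ row₀ s∈row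
  ...   | a , _ , refl = hub→row a
  hub→Z s s∈Z | inj₂ s∈cols with ∈-++⁻ (column zero) s∈cols
  ... | inj₁ s∈col₀ with ∈-map⁻ (upper zero) s∈col₀
  ...   | b , _ , refl = hub→col₀ (suc b)
  hub→Z s s∈Z | inj₂ s∈cols | inj₂ s∈col₁ with ∈-map⁻ (upper (suc zero)) s∈col₁
  ...   | b , _ , refl = hub→col₁ (suc b)

  Z-connectedZeroForcing : IsConnectedZeroForcingSet G Z
  Z-connectedZeroForcing =
    Z-zeroForcing ,
    hub-connected Z hub (⊠-symmetric (cycle-symmetric N) (path-symmetric M)) hub→Z

mainTheorem3 : ∀ (n m : ℕ) → 3 ≤ n → 1 ≤ m →
    ZeroForcingNumber≤ (Cycle n ⊠ PathG m) (n + 2 * m ∸ 2)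
    × ConnectedZeroForcingNumber≤ (Cycle n ⊠ PathG m) (n + 2 * m ∸ 2)
mainTheorem3 (suc (suc (suc n'))) (suc m') _ _ =
  (Z , Z-unique , Z-zeroForcing , small) , (Z , Z-unique , Z-connectedZeroForcing , small)
  where
  open Grid n' m'
  small : length Z ≤ N + 2 * M ∸ 2
  small = ≤-reflexive Z-size
mainTheorem3 (suc (suc (suc _))) zero _ ()
mainTheorem3 (suc (suc zero))    _ (s≤s (s≤s ())) _
mainTheorem3 (suc zero)          _ (s≤s ()) _
mainTheorem3 zero                _ () _
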